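{- Let $\le_t$ be the relation defined by the subtyping rules (refl), (size), (prod), (conv) only (i.e. without the rule (trans)). Then $\le_t$ equals the subtyping relation $\le$.
   Context: Sorts: $\mathcal S=\{\star,\Box\}$. Let $\mathcal X$ be a set of variables and $\mathcal F$ a set of symbols; a set $\mathcal R$ of rewrite rules is given, a symbol is defined if it heads the left-hand side of some rule and constant otherwise; $\mathcal{CF}^\Box$ denotes the constant symbols of sort $\Box$. Size expressions form a first-order term algebra $\mathcal A$ over size symbols and size variables, equipped with a quasi-ordering $\le_{\mathcal A}$. Terms: $t::= s\mid x\mid C^a\mid f\mid [x:t]t\mid (x:t)t\mid tt$ with $s\in\mathcal S$, $C\in\mathcal{CF}^\Box$, $a\in\mathcal A$, $f\in\mathcal F\setminus\mathcal{CF}^\Box$. The reduction $\to$ is $\beta\cup\mathcal R$ closed under contexts and is assumed confluent; $T\downarrow U$ means $T$ and $U$ have a common reduct. Subtyping $\le$ is the smallest relation closed under: (refl) $T\le T$; (size) $C^a\vec t\le C^b\vec t$ when $C\in\mathcal{CF}^\Box$ and $a\le_{\mathcal A}b$; (prod) from $U'\le U$ and $V\le V'$ infer $(x:U)V\le(x:U')V'$; (conv) from $T'\le U'$, $T\downarrow T'$, $U'\downarrow U$ infer $T\le U$; (trans) from $T\le U$ and $U\le V$ infer $T\le V$. -}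

module Defs where

open import Data.Nat using (ℕ; zero; suc)
open import Data.Product using (Σ; ∃; _×_; _,_)
open import Data.List using (List; []; _∷_)
open import Relation.Binary.PropositionalEquality using (_≡_)
open import Relation.Nullary using (¬_)

data Sort : Set where
  ⋆ □ : Sort

-- Sym    : the set F of symbols
--   Size   : the size algebra A (first-order terms over size symbols and
--            size variables; kept abstract)
--   CF□    : the predicate "C ∈ CF^□" (constant symbol of sort □); it is
--            needed to build the syntax, and is tied to the rewrite rules
--            by an explicit hypothesis in the main statement.
--   sortOf : the sort of each symbol (f is "of sort s")
--   _≤A_   : the quasi-ordering on size expressions

record Setting : Set₁ where
  field
    Sym    : Set
    Size   : Set
    CF□    : Sym → Set
    sortOf : Sym → Sort
    _≤A_   : Size → Size → Set

module Syntax (𝒮 : Setting) where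
  open Setting 𝒮 public

  -- Terms, with variables as de Bruijn indices.
  --   t ::= s | x | C^a | f | [x:t]t | (x:t)t | t t
  -- with C ∈ CF^□ and f ∈ F \ CF^□ (the side conditions are irrelevant
  -- arguments, so they do not affect term equality).
  data Term : Set where
    sort  : Sort → Term
    var   : ℕ → Term
    sized : (C : Sym) → .(CF□ C) → Size → Term
    fun   : (f : Sym) → .(¬ CF□ f) → Term
    lam   : Term → Term → Term      -- lam T t  =  [x:T] t   (t under binder)
    pi    : Term → Term → Term      -- pi  T U  =  (x:T) U   (U under binder)
    app   : Term → Term → Term

  apps : Term → List Term → Term
  apps t []       = t
  apps t (u ∷ us) = apps (app t u) us

  ext : (ℕ → ℕ) → ℕ → ℕ
  ext ρ zero    = zero
  ext ρ (suc n) = suc (ρ n)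

  rename : (ℕ → ℕ) → Term → Term
  rename ρ (sort s)      = sort s
  rename ρ (var n)       = var (ρ n)
  rename ρ (sized C p a) = sized C p a
  rename ρ (fun f p)     = fun f p
  rename ρ (lam T t)     = lam (rename ρ T) (rename (ext ρ) t)
  rename ρ (pi T U)      = pi (rename ρ T) (rename (ext ρ) U)
  rename ρ (app t u)     = app (rename ρ t) (rename ρ u)

  exts : (ℕ → Term) → ℕ → Term
  exts σ zero    = var zero
  exts σ (suc n) = rename suc (σ n)

  subst : (ℕ → Term) → Term → Term
  subst σ (sort s)      = sort s
  subst σ (var n)       = σ n
  subst σ (sized C p a) = sized C p a
  subst σ (fun f p)     = fun f p
  subst σ (lam T t)     = lam (subst σ T) (subst (exts σ) t)
  subst σ (pi T U)      = pi (subst σ T) (subst (exts σ) U)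
  subst σ (app t u)     = app (subst σ t) (subst σ u)

  sub0 : Term → ℕ → Term
  sub0 u zero    = u
  sub0 u (suc n) = var n

  _[_] : Term → Term → Term
  t [ u ] = subst (sub0 u) t

  Rules : Set₁
  Rules = Term → Term → Set

  data HeadedBy (f : Sym) : Term → Set where
    here : .(p : ¬ CF□ f) → HeadedBy f (fun f p)
    arg  : ∀ {t u} → HeadedBy f t → HeadedBy f (app t u)

  Defined : Rules → Sym → Set
  Defined ℛ f = Σ Term λ l → Σ Term λ r → ℛ l r × HeadedBy f l

  module Reduction (ℛ : Rules) where

    data _⟶_ : Term → Term → Set where
      beta   : ∀ {T t u} → app (lam T t) u ⟶ (t [ u ])
      rule   : ∀ {l r} (σ : ℕ → Term) → ℛ l r → subst σ l ⟶ subst σ r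
      lamₗ   : ∀ {T T' t} → T ⟶ T' → lam T t ⟶ lam T' t
      lamᵣ   : ∀ {T t t'} → t ⟶ t' → lam T t ⟶ lam T t'
      piₗ    : ∀ {T T' U} → T ⟶ T' → pi T U ⟶ pi T' U
      piᵣ    : ∀ {T U U'} → U ⟶ U' → pi T U ⟶ pi T U'
      appₗ   : ∀ {t t' u} → t ⟶ t' → app t u ⟶ app t' u
      appᵣ   : ∀ {t u u'} → u ⟶ u' → app t u ⟶ app t u'

    data _⟶*_ : Term → Term → Set where
      ε   : ∀ {t} → t ⟶* t
      _◅_ : ∀ {t u v} → t ⟶ u → u ⟶* v → t ⟶* v

    _↓_ : Term → Term → Set
    T ↓ U = ∃ λ W → (T ⟶* W) × (U ⟶* W)

    Confluent : Set
    Confluent = ∀ {t u v} → t ⟶* u → t ⟶* v → u ↓ v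

    data _≤_ : Term → Term → Set where
      refl  : ∀ {T} → T ≤ T
      size  : ∀ {C a b ts} .(p : CF□ C) → a ≤A b →
              apps (sized C p a) ts ≤ apps (sized C p b) ts
      prod  : ∀ {U U' V V'} → U' ≤ U → V ≤ V' → pi U V ≤ pi U' V'
      conv  : ∀ {T T' U U'} → T' ≤ U' → T ↓ T' → U' ↓ U → T ≤ U
      trans : ∀ {T U V} → T ≤ U → U ≤ V → T ≤ V

    data _≤t_ : Term → Term → Set where
      refl  : ∀ {T} → T ≤t T
      size  : ∀ {C a b ts} .(p : CF□ C) → a ≤A b →
              apps (sized C p a) ts ≤t apps (sized C p b) ts
      prod  : ∀ {U U' V V'} → U' ≤t U → V ≤t V' → pi U V ≤t pi U' V'
      conv  : ∀ {T T' U U'} → T' ≤t U' → T ↓ T' → U' ↓ U → T ≤t U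

-- Every ≤-derivation can be put in a normal form: one (size) or (prod) step,
-- or none, between two conversions; this uses confluence to merge adjacent
-- conversions.  Normal forms compose by induction on the derivations: the
-- conversion between two (prod) steps splits into conversions of the domains
-- and codomains, since no rule reduces at a product, and the conversion
-- between two (size) steps identifies the two spines, since a sized constant
-- only reduces inside its arguments.  So (trans) is admissible.
module Submission where

open import Defs
open import Data.Product using (Σ; ∃; ∃₂; _×_; _,_)
open import Data.Empty using (⊥-elim)
open import Data.List using (List; []; _∷_; _∷ʳ_)
open import Relation.Binary.PropositionalEquality
  using (_≡_; _≢_; refl; cong; subst₂; module ≡-Reasoning)
  renaming (subst to transport; sym to ≡-sym)
open import Relation.Nullary using (¬_)
open import Relation.Binary.Structures using (IsPreorder)
open import Relation.Binary.Definitions using (Transitive)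

module _ {𝒮 : Setting} where
  open Syntax 𝒮

  private variable
    t t' u u' A A' B B' T T' U U' V W : Term
    C C' : Sym
    a a' b : Size

  data Spine : Set where
    ∙   : Spine
    _·_ : Spine → Term → Spine

  infixl 25 _·_
  infix 30 _⟪_⟫

  _⟪_⟫ : Spine → Term → Term
  ∙       ⟪ h ⟫ = h
  (E · u) ⟪ h ⟫ = app (E ⟪ h ⟫) u

  _·⋆_ : Spine → List Term → Spine
  E ·⋆ []       = E
  E ·⋆ (u ∷ us) = (E · u) ·⋆ us

  toList : Spine → List Term
  toList ∙       = []
  toList (E · u) = toList E ∷ʳ u

  apps-⟪⟫ : ∀ h E us → apps (E ⟪ h ⟫) us ≡ (E ·⋆ us) ⟪ h ⟫
  apps-⟪⟫ h E []       = refl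
  apps-⟪⟫ h E (u ∷ us) = apps-⟪⟫ h (E · u) us

  apps-∷ʳ : ∀ h us u → apps h (us ∷ʳ u) ≡ app (apps h us) u
  apps-∷ʳ h []       u = refl
  apps-∷ʳ h (v ∷ us) u = apps-∷ʳ (app h v) us u

  apps-toList : ∀ h E → apps h (toList E) ≡ E ⟪ h ⟫
  apps-toList h ∙       = refl
  apps-toList h (E · u) = begin
    apps h (toList E ∷ʳ u)   ≡⟨ apps-∷ʳ h (toList E) u ⟩
    app (apps h (toList E)) u ≡⟨ cong (λ t → app t u) (apps-toList h E) ⟩
    app (E ⟪ h ⟫) u           ∎
    where open ≡-Reasoning

  app-injective : app t u ≡ app t' u' → t ≡ t' × u ≡ u'
  app-injective refl = refl , refl

  ⟪sized⟫-injective : ∀ E E' .{p : CF□ C} .{p' : CF□ C'} →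
    E ⟪ sized C p a ⟫ ≡ E' ⟪ sized C' p' a' ⟫ → E ≡ E' × C ≡ C' × a ≡ a'
  ⟪sized⟫-injective ∙       ∙         refl = refl , refl , refl
  ⟪sized⟫-injective (E · u) (E' · u') eq with app-injective eq
  ... | eqE , refl with ⟪sized⟫-injective E E' eqE
  ... | refl , refl , refl = refl , refl , refl

  ⟪sized⟫≢pi : ∀ E .{p : CF□ C} → E ⟪ sized C p a ⟫ ≢ pi A B
  ⟪sized⟫≢pi ∙       ()
  ⟪sized⟫≢pi (E · u) ()

  HeadedBy-subst : ∀ {f} σ → HeadedBy f t → HeadedBy f (subst σ t)
  HeadedBy-subst σ (here p) = here p
  HeadedBy-subst σ (arg h)  = arg (HeadedBy-subst σ h)

  ⟪sized⟫-unheaded : ∀ {f} E .{p : CF□ C} → ¬ HeadedBy f (E ⟪ sized C p a ⟫)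
  ⟪sized⟫-unheaded (E · u) (arg h) = ⟪sized⟫-unheaded E h

  LeftHeaded : Rules → Set
  LeftHeaded ℛ = ∀ l r → ℛ l r → Σ Sym λ f → HeadedBy f l

  module _ {ℛ : Rules} where
    open Reduction ℛ

    _◅◅_ : T ⟶* U → U ⟶* V → T ⟶* V
    ε       ◅◅ ss = ss
    (s ◅ r) ◅◅ ss = s ◅ (r ◅◅ ss)

    ↓-refl : T ↓ T
    ↓-refl = _ , ε , ε

    ↓-reflexive : T ≡ U → T ↓ U
    ↓-reflexive refl = ↓-refl

    ↓-sym : T ↓ U → U ↓ T
    ↓-sym (W , r , s) = W , s , r

    ↓-trans : Confluent → T ↓ U → U ↓ V → T ↓ V
    ↓-trans confluent (_ , r₁ , s₁) (_ , r₂ , s₂) with confluent s₁ r₂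
    ... | W , r , s = W , r₁ ◅◅ r , s₂ ◅◅ s

    module _ (headed : LeftHeaded ℛ) where

      -- Root steps are impossible below: a rule redex is headed by a
      -- symbol, a product or a sized spine is not.
      pi-⟶ : T ≡ pi A B → T ⟶ W →
        ∃₂ λ A' B' → W ≡ pi A' B' × A ⟶* A' × B ⟶* B'
      pi-⟶ eq (rule σ ρ) with headed _ _ ρ
      ... | f , h with transport (HeadedBy f) eq (HeadedBy-subst σ h)
      ... | ()
      pi-⟶ refl (piₗ s) = _ , _ , refl , s ◅ ε , ε
      pi-⟶ refl (piᵣ s) = _ , _ , refl , ε , s ◅ ε

      pi-⟶* : pi A B ⟶* W → ∃₂ λ A' B' → W ≡ pi A' B' × A ⟶* A' × B ⟶* B'
      pi-⟶* ε = _ , _ , refl , ε , ε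
      pi-⟶* (s ◅ r) with pi-⟶ refl s
      ... | _ , _ , refl , rA , rB with pi-⟶* r
      ... | A' , B' , eq , rA' , rB' = A' , B' , eq , rA ◅◅ rA' , rB ◅◅ rB'

      pi-↓-injective : pi A B ↓ pi A' B' → A ↓ A' × B ↓ B'
      pi-↓-injective (W , r , s) with pi-⟶* r | pi-⟶* s
      ... | _ , _ , refl , rA , rB | _ , _ , refl , sA , sB =
        (_ , rA , sA) , (_ , rB , sB)

      ⟪sized⟫-⟶ : ∀ E .{p : CF□ C} → T ≡ E ⟪ sized C p b ⟫ → T ⟶ W →
        ∃ λ E' → W ≡ E' ⟪ sized C p b ⟫ × (∀ a → E ⟪ sized C p a ⟫ ⟶ E' ⟪ sized C p a ⟫)
      ⟪sized⟫-⟶ E eq (rule σ ρ) with headed _ _ ρ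
      ... | f , h = ⊥-elim (⟪sized⟫-unheaded E (transport (HeadedBy f) eq (HeadedBy-subst σ h)))
      ⟪sized⟫-⟶ (E · u) refl (appₗ s) with ⟪sized⟫-⟶ E refl s
      ... | E' , refl , step = E' · u , refl , λ a → appₗ (step a)
      ⟪sized⟫-⟶ (E · u) refl (appᵣ s) = E · _ , refl , λ a → appᵣ s
      ⟪sized⟫-⟶ ∙           () beta
      ⟪sized⟫-⟶ (∙ · _)     () beta
      ⟪sized⟫-⟶ (_ · _ · _) () beta
      ⟪sized⟫-⟶ ∙           () (lamₗ _)
      ⟪sized⟫-⟶ ∙           () (lamᵣ _)
      ⟪sized⟫-⟶ ∙           () (piₗ _)
      ⟪sized⟫-⟶ ∙           () (piᵣ _)
      ⟪sized⟫-⟶ (_ · _)     () (lamₗ _)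
      ⟪sized⟫-⟶ (_ · _)     () (lamᵣ _)
      ⟪sized⟫-⟶ (_ · _)     () (piₗ _)
      ⟪sized⟫-⟶ (_ · _)     () (piᵣ _)

      ⟪sized⟫-⟶* : ∀ E .{p : CF□ C} → E ⟪ sized C p b ⟫ ⟶* W →
        ∃ λ E' → W ≡ E' ⟪ sized C p b ⟫ × (∀ a → E ⟪ sized C p a ⟫ ⟶* E' ⟪ sized C p a ⟫)
      ⟪sized⟫-⟶* E ε = E , refl , λ a → ε
      ⟪sized⟫-⟶* E (s ◅ r) with ⟪sized⟫-⟶ E refl s
      ... | E' , refl , step with ⟪sized⟫-⟶* E' r
      ... | E″ , eq , steps = E″ , eq , λ a → step a ◅ steps a

      ⟪sized⟫-↓-pi : ∀ E .{p : CF□ C} → ¬ (E ⟪ sized C p a ⟫ ↓ pi A B)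
      ⟪sized⟫-↓-pi E (W , r , s) with ⟪sized⟫-⟶* E r | pi-⟶* s
      ... | E' , refl , _ | _ , _ , eq , _ = ⟪sized⟫≢pi E' eq

    infix 4 _≼_
    data _≼_ : Term → Term → Set where
      join : T ↓ U → T ≼ U
      size : ∀ E .(p : CF□ C) → T ↓ E ⟪ sized C p a ⟫ → a ≤A b →
             E ⟪ sized C p b ⟫ ↓ U → T ≼ U
      prod : T ↓ pi A B → A' ≼ A → B ≼ B' → pi A' B' ↓ U → T ≼ U

    ≼⇒≤t : T ≼ U → T ≤t U
    ≼⇒≤t (join j) = conv refl j ↓-refl
    ≼⇒≤t (size E p j a≤b j') =
      conv (subst₂ _≤t_ (apps-toList _ E) (apps-toList _ E) (size {ts = toList E} p a≤b)) j j'
    ≼⇒≤t (prod j x y j') = conv (prod (≼⇒≤t x) (≼⇒≤t y)) j j'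

    ≤t⇒≤ : T ≤t U → T ≤ U
    ≤t⇒≤ refl                   = refl
    ≤t⇒≤ (size {ts = ts} p a≤b) = size {ts = ts} p a≤b
    ≤t⇒≤ (prod x y)             = prod (≤t⇒≤ x) (≤t⇒≤ y)
    ≤t⇒≤ (conv x j j')          = conv (≤t⇒≤ x) j j'

    module _ (confluent : Confluent) where

      ≼-respˡ : T ↓ T' → T' ≼ U → T ≼ U
      ≼-respˡ j (join k)           = join (↓-trans confluent j k)
      ≼-respˡ j (size E p k a≤b l) = size E p (↓-trans confluent j k) a≤b l
      ≼-respˡ j (prod k x y l)     = prod (↓-trans confluent j k) x y l

      ≼-respʳ : T ≼ U' → U' ↓ U → T ≼ U
      ≼-respʳ (join k) j           = join (↓-trans confluent k j)
      ≼-respʳ (size E p k a≤b l) j = size E p k a≤b (↓-trans confluent l j)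
      ≼-respʳ (prod k x y l) j     = prod k x y (↓-trans confluent l j)

      module _ (headed : LeftHeaded ℛ) (≤A-trans : Transitive _≤A_) where

        -- The middle conversion is threaded through the induction, so that in
        -- the (prod)/(prod) case the recursive calls are on immediate
        -- subderivations (with the two arguments swapped for the domains).
        ≼-trans : T ≼ U → U ↓ U' → U' ≼ V → T ≼ V
        ≼-trans (join j) k y = ≼-respˡ (↓-trans confluent j k) y
        ≼-trans x k (join j) = ≼-respʳ x (↓-trans confluent k j)
        ≼-trans (size E p j a≤b j') k (size F q l b'≤c l')
          with ↓-trans confluent j' (↓-trans confluent k l)
        ... | _ , r , s with ⟪sized⟫-⟶* headed E r | ⟪sized⟫-⟶* headed F s
        ... | E' , refl , rE | F' , eq , sF with ⟪sized⟫-injective E' F' eq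
        ... | refl , refl , refl =
          size E' p (↓-trans confluent j (_ , rE _ , ε)) (≤A-trans a≤b b'≤c)
                    (↓-trans confluent (_ , ε , sF _) l')
        ≼-trans (size E p j _ j') k (prod l _ _ _) =
          ⊥-elim (⟪sized⟫-↓-pi headed E (↓-trans confluent j' (↓-trans confluent k l)))
        ≼-trans (prod j _ _ j') k (size F q l _ _) =
          ⊥-elim (⟪sized⟫-↓-pi headed F (↓-sym (↓-trans confluent j' (↓-trans confluent k l))))
        ≼-trans (prod j x₁ x₂ j') k (prod l y₁ y₂ l')
          with pi-↓-injective headed (↓-trans confluent j' (↓-trans confluent k l))
        ... | dom , cod = prod j (≼-trans y₁ (↓-sym dom) x₁) (≼-trans x₂ cod y₂) l'

        ≤⇒≼ : T ≤ U → T ≼ U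
        ≤⇒≼ refl                   = join ↓-refl
        ≤⇒≼ (size {ts = ts} p a≤b) =
          size (∙ ·⋆ ts) p (↓-reflexive (apps-⟪⟫ _ ∙ ts)) a≤b
               (↓-reflexive (≡-sym (apps-⟪⟫ _ ∙ ts)))
        ≤⇒≼ (prod x y)             = prod ↓-refl (≤⇒≼ x) (≤⇒≼ y) ↓-refl
        ≤⇒≼ (conv x j j')          = ≼-respˡ j (≼-respʳ (≤⇒≼ x) j')
        ≤⇒≼ (trans x y)            = ≼-trans (≤⇒≼ x) ↓-refl (≤⇒≼ y)

mainTheorem2 : (𝒮 : Setting) → let open Syntax 𝒮 in
    (ℛ : Rules) →
    IsPreorder _≡_ _≤A_ →
    (∀ l r → ℛ l r → Σ Sym λ f → HeadedBy f l) →
    (∀ f → (CF□ f → (sortOf f ≡ □) × ¬ Defined ℛ f)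
         × ((sortOf f ≡ □) × ¬ Defined ℛ f → CF□ f)) →
    let open Reduction ℛ in
    Confluent →
    ∀ T U → (T ≤t U → T ≤ U) × (T ≤ U → T ≤t U)
mainTheorem2 𝒮 ℛ ≤A-preorder headed _ confluent T U =
  ≤t⇒≤ , λ T≤U → ≼⇒≤t (≤⇒≼ confluent headed (IsPreorder.trans ≤A-preorder) T≤U)
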